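{- In the Sequential Truncated-Pivot algorithm, conditioned on the event that for every iteration $i$ every node $u$ put into a singleton cluster in iteration $i$ satisfies $\deg_i(u)\le\varepsilon\cdot\deg(u)$, we have $|E^{\mathrm{bad}}|\le 2\varepsilon\cdot|E^{\mathrm{sin}}|$.
   Context: $G=(V,E^+)$ is a simple undirected graph on $n$ nodes, $\deg(u)$ the degree of $u$ in $G$. Sequential Truncated-Pivot: all nodes start active. Pick a uniformly random permutation $\pi:V\to\{1,\dots,n\}$. For $i=1,\dots,n$: let $\ell_i=\frac{c}{\varepsilon}\cdot\frac{n\log n}{i}$ and $w$ the node with $\pi_w=i$; every active node $v$ with $\deg(v)\ge\ell_i$ becomes inactive and is put into a singleton cluster; then if $w$ is active, create a pivot cluster of $w$ and its active neighbors, all of which become inactive. $N_i(u)$ is the set of neighbors $v$ of $u$ with $\deg(v)\le\deg(u)$ that are not in a pivot cluster at the beginning of iteration $i$; $\deg_i(u)=|N_i(u)|$. $E^{\mathrm{sin}}$ is the set of positive edges incident on nodes put into singleton clusters. An edge $\{u,v\}\in E^{\mathrm{sin}}$, where $u$'s singleton cluster was created in iteration $i$, is good if $v$ was included in a pivot cluster in some iteration $j<i$, and bad otherwise; $E^{\mathrm{bad}}$ is the set of bad edges.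
   Formalization: The parameter ε ranges over the nonnegative rationals, in the event on $\deg_i(u)$ and in the bound alike. -}

module Defs where

open import Data.Nat using (ℕ; zero; suc; _+_; _*_; _≤ᵇ_; _<ᵇ_; _≡ᵇ_; pred)
open import Data.Nat.Properties using (_<?_)
open import Data.Bool using (Bool; true; false; if_then_else_; _∧_; _∨_; not)
open import Data.Fin using (Fin; toℕ; fromℕ<)
open import Data.Fin.Permutation using (Permutation′; _⟨$⟩ˡ_)
open import Data.List using (List; []; _∷_; allFin)
open import Data.Maybe using (Maybe; just; nothing)
open import Relation.Binary.PropositionalEquality using (_≡_)
open import Relation.Nullary using (yes; no)

count : {A : Set} → (A → Bool) → List A → ℕ
count P []       = 0
count P (x ∷ xs) = if P x then suc (count P xs) else count P xs

sumL : {A : Set} → (A → ℕ) → List A → ℕ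
sumL f []       = 0
sumL f (x ∷ xs) = f x + sumL f xs

record SimpleGraph (n : ℕ) : Set where
  field
    adj    : Fin n → Fin n → Bool
    sym    : ∀ u v → adj u v ≡ adj v u
    irrefl : ∀ u → adj u u ≡ false

-- Status of a node: still active, put into a singleton cluster in
-- iteration i, or put into a pivot cluster in iteration i (1-based).
data Status : Set where
  active : Status
  single : ℕ → Status
  pivot  : ℕ → Status

isActive : Status → Bool
isActive active = true
isActive _      = false

isSingle : Status → Bool
isSingle (single _) = true
isSingle _          = false

isPivot : Status → Bool
isPivot (pivot _) = true
isPivot _         = false

eqF : {n : ℕ} → Fin n → Fin n → Bool
eqF u v = toℕ u ≡ᵇ toℕ v

-- Sequential Truncated-Pivot.
--  π sends a node w to its position π_w (0-based here: position k is
--  iteration k+1).  K stands for the real number (c/ε)·n·log n: the test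
--  deg(v) ≥ ℓ_i = K / i is performed as  K ≤ deg(v)·i.
module TruncatedPivot {n : ℕ} (G : SimpleGraph n) (π : Permutation′ n) (K : ℕ) where
  open SimpleGraph G

  nodes : List (Fin n)
  nodes = allFin n

  deg : Fin n → ℕ
  deg u = count (adj u) nodes

  State : Set
  State = Fin n → Status

  step : ℕ → Fin n → State → State
  step i w s v =
    if isActive (s₁ w) ∧ (eqF v w ∨ (adj w v ∧ isActive (s₁ v)))
    then pivot i else s₁ v
    where
    s₁ : State
    s₁ x = if isActive (s x) ∧ (K ≤ᵇ deg x * i) then single i else s x

  nodeAt : ℕ → Maybe (Fin n)
  nodeAt k with k <? n
  ... | yes k<n = just (π ⟨$⟩ˡ fromℕ< k<n)
  ... | no  _   = nothing

  after : ℕ → State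
  after zero    = λ _ → active
  after (suc k) with nodeAt k
  ... | just w  = step (suc k) w (after k)
  ... | nothing = after k

  final : State
  final = after n

  atStartOf : ℕ → State
  atStartOf i = after (pred i)

  inN : ℕ → Fin n → Fin n → Bool
  inN i u v = adj u v ∧ (deg v ≤ᵇ deg u) ∧ not (isPivot (atStartOf i v))

  degAt : ℕ → Fin n → ℕ
  degAt i u = count (inN i u) nodes

  countEdges : (Fin n → Fin n → Bool) → ℕ
  countEdges P = sumL (λ u → count (λ v → (toℕ u <ᵇ toℕ v) ∧ adj u v ∧ P u v) nodes) nodes

  sinEdge : Fin n → Fin n → Bool
  sinEdge u v = isSingle (final u) ∨ isSingle (final v)

  pivotBefore : Fin n → ℕ → Bool
  pivotBefore v i with final v
  ... | pivot j = j <ᵇ i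
  ... | _       = false

  badDir : Fin n → Fin n → Bool
  badDir u v with final u
  ... | single i = not (pivotBefore v i)
  ... | _        = false

  badEdge : Fin n → Fin n → Bool
  badEdge u v = badDir u v ∨ badDir v u

  |Esin| : ℕ
  |Esin| = countEdges sinEdge

  |Ebad| : ℕ
  |Ebad| = countEdges badEdge

module Submission where

-- A bad edge {u,v}, with u made a singleton in iteration i, is charged to one endpoint whose
-- set N is known to contain the other.  If deg v ≤ deg u then v ∈ N_i(u), because v was not
-- pivoted before iteration i.  Otherwise v, having larger degree, crossed the threshold no
-- later than u and became a singleton in some iteration j ≤ i, at whose start u was still
-- active, so u ∈ N_j(v).  Hence q |E^bad| ≤ q Σ_u deg_{i_u}(u) ≤ p Σ_u deg(u) over the
-- singletons u, and the latter sum counts each edge of E^sin at most twice.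

open import Defs
open import Data.Nat using (ℕ; zero; suc; _+_; _*_; pred; _≤_; _<_; _≤′_; ≤′-refl; ≤′-step; _≤ᵇ_; _<ᵇ_; z≤n; s≤s)
open import Data.Nat.Properties
open import Data.Bool using (Bool; true; false; if_then_else_; _∧_; _∨_; not; T)
open import Data.Bool.Properties using (T-≡; ∨-comm)
open import Data.Fin using (Fin; toℕ)
open import Data.Fin.Properties using (toℕ-injective)
open import Data.Fin.Permutation using (Permutation′)
open import Data.List using (List; []; _∷_)
open import Data.Maybe using (just; nothing)
open import Data.Product using (Σ-syntax; _×_; _,_; proj₁; proj₂)
open import Data.Sum using (_⊎_; inj₁; inj₂; swap)
open import Data.Empty using (⊥-elim)
open import Function using (Equivalence)
open import Relation.Nullary using (¬_; yes; no)
open import Relation.Binary.PropositionalEquality using (_≡_; refl; sym; trans; cong; cong₂; subst; module ≡-Reasoning)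
open import Relation.Binary.Definitions using (tri<; tri≈; tri>)

T⇒≡true : ∀ {b} → T b → b ≡ true
T⇒≡true = Equivalence.to T-≡

≡true⇒T : ∀ {b} → b ≡ true → T b
≡true⇒T = Equivalence.from T-≡

≮⇒<ᵇ≡false : ∀ {m n} → ¬ m < n → (m <ᵇ n) ≡ false
≮⇒<ᵇ≡false {m} {n} m≮n with m <ᵇ n in m<ᵇn
... | false = refl
... | true  = ⊥-elim (m≮n (<ᵇ⇒< m n (≡true⇒T m<ᵇn)))

indicator : Bool → ℕ
indicator true  = 1
indicator false = 0

indicator-+-positive : ∀ {b c} → (b ≡ true) ⊎ (c ≡ true) → 1 ≤ indicator b + indicator c
indicator-+-positive {true}          _         = s≤s z≤n
indicator-+-positive {false} {true}  _         = ≤-refl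
indicator-+-positive {false} {false} (inj₁ ())
indicator-+-positive {false} {false} (inj₂ ())

module _ {A : Set} where

  count≡sumL-indicator : ∀ (P : A → Bool) xs → count P xs ≡ sumL (λ x → indicator (P x)) xs
  count≡sumL-indicator P []       = refl
  count≡sumL-indicator P (x ∷ xs) with P x
  ... | true  = cong suc (count≡sumL-indicator P xs)
  ... | false = count≡sumL-indicator P xs

  count-false : ∀ (xs : List A) → count (λ _ → false) xs ≡ 0
  count-false []       = refl
  count-false (x ∷ xs) = count-false xs

  sumL-zero : ∀ (xs : List A) → sumL (λ _ → 0) xs ≡ 0
  sumL-zero []       = refl
  sumL-zero (x ∷ xs) = sumL-zero xs

  sumL-cong : ∀ {f g : A → ℕ} → (∀ x → f x ≡ g x) → ∀ xs → sumL f xs ≡ sumL g xs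
  sumL-cong f≡g []       = refl
  sumL-cong f≡g (x ∷ xs) = cong₂ _+_ (f≡g x) (sumL-cong f≡g xs)

  sumL-mono-≤ : ∀ {f g : A → ℕ} → (∀ x → f x ≤ g x) → ∀ xs → sumL f xs ≤ sumL g xs
  sumL-mono-≤ f≤g []       = z≤n
  sumL-mono-≤ f≤g (x ∷ xs) = +-mono-≤ (f≤g x) (sumL-mono-≤ f≤g xs)

  sumL-distrib-+ : ∀ (f g : A → ℕ) xs → sumL (λ x → f x + g x) xs ≡ sumL f xs + sumL g xs
  sumL-distrib-+ f g []       = refl
  sumL-distrib-+ f g (x ∷ xs) rewrite sumL-distrib-+ f g xs =
    +-comm-middle (f x) (g x) (sumL f xs) (sumL g xs)
    where
    +-comm-middle : ∀ a b c d → a + b + (c + d) ≡ a + c + (b + d)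
    +-comm-middle a b c d rewrite +-assoc a b (c + d) | +-assoc a c (b + d)
      | sym (+-assoc b c d) | +-comm b c | +-assoc c b d = refl

  *-distribˡ-sumL : ∀ c (f : A → ℕ) xs → c * sumL f xs ≡ sumL (λ x → c * f x) xs
  *-distribˡ-sumL c f []       = *-zeroʳ c
  *-distribˡ-sumL c f (x ∷ xs) rewrite sym (*-distribˡ-sumL c f xs) = *-distribˡ-+ c (f x) (sumL f xs)

sumL-comm : ∀ {A B : Set} (f : A → B → ℕ) xs ys →
            sumL (λ x → sumL (f x) ys) xs ≡ sumL (λ y → sumL (λ x → f x y) xs) ys
sumL-comm f []       ys = sym (sumL-zero ys)
sumL-comm f (x ∷ xs) ys rewrite sumL-comm f xs ys =
  sym (sumL-distrib-+ (f x) (λ y → sumL (λ x → f x y) xs) ys)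

module _ {A : Set} where

  sumL² : (A → A → ℕ) → List A → ℕ
  sumL² f xs = sumL (λ x → sumL (f x) xs) xs

  sumL²-cong : ∀ {f g : A → A → ℕ} → (∀ x y → f x y ≡ g x y) → ∀ xs → sumL² f xs ≡ sumL² g xs
  sumL²-cong f≡g xs = sumL-cong (λ x → sumL-cong (f≡g x) xs) xs

  sumL²-mono-≤ : ∀ {f g : A → A → ℕ} → (∀ x y → f x y ≤ g x y) → ∀ xs → sumL² f xs ≤ sumL² g xs
  sumL²-mono-≤ f≤g xs = sumL-mono-≤ (λ x → sumL-mono-≤ (f≤g x) xs) xs

  sumL²-symmetrize : ∀ (f : A → A → ℕ) xs → sumL² (λ x y → f x y + f y x) xs ≡ 2 * sumL² f xs
  sumL²-symmetrize f xs = begin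
    sumL² (λ x y → f x y + f y x) xs
      ≡⟨ sumL-cong (λ x → sumL-distrib-+ (f x) (λ y → f y x) xs) xs ⟩
    sumL (λ x → sumL (f x) xs + sumL (λ y → f y x) xs) xs
      ≡⟨ sumL-distrib-+ _ _ xs ⟩
    sumL² f xs + sumL (λ x → sumL (λ y → f y x) xs) xs
      ≡⟨ cong (sumL² f xs +_) (sym (sumL-comm f xs xs)) ⟩
    sumL² f xs + sumL² f xs
      ≡⟨ cong (sumL² f xs +_) (sym (+-identityʳ (sumL² f xs))) ⟩
    2 * sumL² f xs ∎
    where open ≡-Reasoning

module EdgeCounting {n : ℕ} (G : SimpleGraph n) (π : Permutation′ n) (K : ℕ) where
  open SimpleGraph G using (adj) renaming (sym to adj-sym; irrefl to adj-irrefl)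
  open TruncatedPivot G π K

  orientedEdge : (Fin n → Fin n → Bool) → Fin n → Fin n → ℕ
  orientedEdge P u v = indicator ((toℕ u <ᵇ toℕ v) ∧ adj u v ∧ P u v)

  orientedEdge-pair : ∀ P → (∀ u v → P u v ≡ P v u) → ∀ u v →
                      orientedEdge P u v + orientedEdge P v u ≡ indicator (adj u v ∧ P u v)
  orientedEdge-pair P P-sym u v with <-cmp (toℕ u) (toℕ v)
  ... | tri< u<v _ v≮u rewrite T⇒≡true (<⇒<ᵇ u<v) | ≮⇒<ᵇ≡false v≮u = +-identityʳ _
  ... | tri> u≮v _ v<u rewrite T⇒≡true (<⇒<ᵇ v<u) | ≮⇒<ᵇ≡false u≮v
                             | adj-sym v u | P-sym v u = refl
  ... | tri≈ u≮v u≡v v≮u rewrite ≮⇒<ᵇ≡false u≮v | ≮⇒<ᵇ≡false v≮u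
                               | trans (cong (adj u) (sym (toℕ-injective u≡v))) (adj-irrefl u) = refl

  double-countEdges : ∀ P → (∀ u v → P u v ≡ P v u) →
                      2 * countEdges P ≡ sumL² (λ u v → indicator (adj u v ∧ P u v)) nodes
  double-countEdges P P-sym = begin
    2 * countEdges P
      ≡⟨ cong (2 *_) (sumL-cong (λ u → count≡sumL-indicator _ nodes) nodes) ⟩
    2 * sumL² (orientedEdge P) nodes
      ≡⟨ sym (sumL²-symmetrize (orientedEdge P) nodes) ⟩
    sumL² (λ u v → orientedEdge P u v + orientedEdge P v u) nodes
      ≡⟨ sumL²-cong (orientedEdge-pair P P-sym) nodes ⟩
    sumL² (λ u v → indicator (adj u v ∧ P u v)) nodes ∎
    where open ≡-Reasoning

module Dynamics {n : ℕ} (G : SimpleGraph n) (π : Permutation′ n) (K : ℕ) where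
  open SimpleGraph G using (adj)
  open TruncatedPivot G π K

  -- The two phases of iteration i: step i w is definitionally pivotOn i w ∘ truncate i.
  truncate : ℕ → State → State
  truncate i s x = if isActive (s x) ∧ (K ≤ᵇ deg x * i) then single i else s x

  pivotOn : ℕ → Fin n → State → State
  pivotOn i w t v = if isActive (t w) ∧ (eqF v w ∨ (adj w v ∧ isActive (t v))) then pivot i else t v

  eqF⇒≡ : ∀ {v w : Fin n} → eqF v w ≡ true → v ≡ w
  eqF⇒≡ {v} {w} v≟w = toℕ-injective (≡ᵇ⇒≡ (toℕ v) (toℕ w) (≡true⇒T v≟w))

  pivotOn-inactive : ∀ i w t v → isActive (t v) ≡ false → pivotOn i w t v ≡ t v
  pivotOn-inactive i w t v inactive with eqF v w in v≟w
  ... | true with eqF⇒≡ {v} {w} v≟w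
  ...   | refl rewrite inactive = refl
  pivotOn-inactive i w t v inactive | false with isActive (t w) | adj w v
  ... | false | _     = refl
  ... | true  | false = refl
  ... | true  | true  rewrite inactive = refl

  pivotOn-cases : ∀ i w t v → (pivotOn i w t v ≡ pivot i) ⊎ (pivotOn i w t v ≡ t v)
  pivotOn-cases i w t v with isActive (t w) ∧ (eqF v w ∨ (adj w v ∧ isActive (t v)))
  ... | true  = inj₁ refl
  ... | false = inj₂ refl

  truncate-active : ∀ i s v → s v ≡ active → truncate i s v ≡ (if K ≤ᵇ deg v * i then single i else active)
  truncate-active i s v v-active rewrite v-active = refl

  truncate-inactive : ∀ i s v → isActive (s v) ≡ false → truncate i s v ≡ s v
  truncate-inactive i s v inactive rewrite inactive = refl

  step-inactive : ∀ i w s v → isActive (s v) ≡ false → step i w s v ≡ s v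
  step-inactive i w s v inactive =
    trans (pivotOn-inactive i w (truncate i s) v (trans (cong isActive stays) inactive)) stays
    where
    stays : truncate i s v ≡ s v
    stays = truncate-inactive i s v inactive

  step-reaching-threshold : ∀ i w s v → s v ≡ active → (K ≤ᵇ deg v * i) ≡ true → step i w s v ≡ single i
  step-reaching-threshold i w s v v-active threshold =
    trans (pivotOn-inactive i w (truncate i s) v (cong isActive singled)) singled
    where
    singled : truncate i s v ≡ single i
    singled = trans (truncate-active i s v v-active) (cong (if_then single i else active) threshold)

  step-below-threshold : ∀ i w s v → s v ≡ active → (K ≤ᵇ deg v * i) ≡ false →
                         (step i w s v ≡ pivot i) ⊎ (step i w s v ≡ active)
  step-below-threshold i w s v v-active below with pivotOn-cases i w (truncate i s) v
  ... | inj₁ pivoted = inj₁ pivoted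
  ... | inj₂ kept    =
    inj₂ (trans kept (trans (truncate-active i s v v-active) (cong (if_then single i else active) below)))

  after-suc : ∀ k → (∀ v → after (suc k) v ≡ after k v)
                    ⊎ Σ[ w ∈ Fin n ] (∀ v → after (suc k) v ≡ step (suc k) w (after k) v)
  after-suc k with nodeAt k
  ... | just w  = inj₂ (w , λ v → refl)
  ... | nothing = inj₁ (λ v → refl)

  after-suc-inactive : ∀ k v → isActive (after k v) ≡ false → after (suc k) v ≡ after k v
  after-suc-inactive k v inactive with after-suc k
  ... | inj₁ idle       = idle v
  ... | inj₂ (w , next) = trans (next v) (step-inactive (suc k) w (after k) v inactive)

  after-suc-active : ∀ k v → after k v ≡ active →
                     (after (suc k) v ≡ active) ⊎ (after (suc k) v ≡ pivot (suc k))
                     ⊎ (after (suc k) v ≡ single (suc k) × (K ≤ᵇ deg v * suc k) ≡ true)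
  after-suc-active k v v-active with after-suc k
  ... | inj₁ idle = inj₁ (trans (idle v) v-active)
  ... | inj₂ (w , next) with K ≤ᵇ deg v * suc k in threshold
  ...   | true  = inj₂ (inj₂ (trans (next v) (step-reaching-threshold (suc k) w (after k) v v-active threshold) , refl))
  ...   | false with step-below-threshold (suc k) w (after k) v v-active threshold
  ...     | inj₁ pivoted = inj₂ (inj₁ (trans (next v) pivoted))
  ...     | inj₂ kept    = inj₁ (trans (next v) kept)

  singletons-simultaneous : ∀ k u v → after k u ≡ active → after (suc k) u ≡ single (suc k) →
                            after k v ≡ active → (K ≤ᵇ deg v * suc k) ≡ true → after (suc k) v ≡ single (suc k)
  singletons-simultaneous k u v u-active u-single v-active threshold with after-suc k
  ... | inj₁ idle with trans (sym u-single) (trans (idle u) u-active)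
  ...   | ()
  singletons-simultaneous k u v u-active u-single v-active threshold | inj₂ (w , next) =
    trans (next v) (step-reaching-threshold (suc k) w (after k) v v-active threshold)

  after-suc-cases : ∀ k v → (after (suc k) v ≡ after k v)
                           ⊎ (after k v ≡ active
                              × ((after (suc k) v ≡ pivot (suc k))
                                 ⊎ (after (suc k) v ≡ single (suc k) × (K ≤ᵇ deg v * suc k) ≡ true)))
  after-suc-cases k v with after k v in ev
  ... | single _ = inj₁ (trans (after-suc-inactive k v (cong isActive ev)) ev)
  ... | pivot _  = inj₁ (trans (after-suc-inactive k v (cong isActive ev)) ev)
  ... | active with after-suc-active k v ev
  ...   | inj₁ kept    = inj₁ kept
  ...   | inj₂ changed = inj₂ (refl , changed)

  after-suc-active⇒active : ∀ k v → after (suc k) v ≡ active → after k v ≡ active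
  after-suc-active⇒active k v v-active with after-suc-cases k v
  ... | inj₁ same       = trans (sym same) v-active
  ... | inj₂ (was , _)  = was

  after-stable : ∀ {m m'} v → m ≤ m' → isActive (after m v) ≡ false → after m' v ≡ after m v
  after-stable {m} v m≤m' inactive = go (≤⇒≤′ m≤m')
    where
    go : ∀ {m'} → m ≤′ m' → after m' v ≡ after m v
    go ≤′-refl        = refl
    go (≤′-step m≤′k) = trans (after-suc-inactive _ v (trans (cong isActive (go m≤′k)) inactive)) (go m≤′k)

  active-earlier : ∀ {m k} v → m ≤ k → after k v ≡ active → after m v ≡ active
  active-earlier {m} v m≤k = go (≤⇒≤′ m≤k)
    where
    go : ∀ {k} → m ≤′ k → after k v ≡ active → after m v ≡ active
    go ≤′-refl        v-active = v-active
    go (≤′-step m≤′k) v-active = go m≤′k (after-suc-active⇒active _ v v-active)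

  pivot-stamp : ∀ k v j → after k v ≡ pivot j → j ≤ k
  pivot-stamp zero    v j ()
  pivot-stamp (suc k) v j v-pivot with after-suc-cases k v
  ... | inj₁ same = m≤n⇒m≤1+n (pivot-stamp k v j (trans (sym same) v-pivot))
  ... | inj₂ (_ , inj₁ pivoted) with trans (sym v-pivot) pivoted
  ...   | refl = ≤-refl
  pivot-stamp (suc k) v j v-pivot | inj₂ (_ , inj₂ (singled , _)) with trans (sym v-pivot) singled
  ...   | ()

  record SingledAt (v : Fin n) (j : ℕ) : Set where
    field
      active-before  : after (pred j) v ≡ active
      threshold      : (K ≤ᵇ deg v * j) ≡ true
      single-after   : after j v ≡ single j

  single-stamp : ∀ k v j → after k v ≡ single j → j ≤ k × SingledAt v j
  single-stamp zero    v j ()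
  single-stamp (suc k) v j v-single with after-suc-cases k v
  ... | inj₁ same with single-stamp k v j (trans (sym same) v-single)
  ...   | j≤k , stamp = m≤n⇒m≤1+n j≤k , stamp
  single-stamp (suc k) v j v-single | inj₂ (_ , inj₁ pivoted) with trans (sym v-single) pivoted
  ...   | ()
  single-stamp (suc k) v j v-single | inj₂ (was , inj₂ (singled , threshold)) with trans (sym v-single) singled
  ...   | refl = ≤-refl , record { active-before = was ; threshold = threshold ; single-after = v-single }

  pivotBefore-pivot : ∀ {v j} i → final v ≡ pivot j → pivotBefore v i ≡ (j <ᵇ i)
  pivotBefore-pivot {v} i fv with final v | fv
  ... | .(pivot _) | refl = refl

  not-pivoted-early : ∀ k v → k ≤ n → not (pivotBefore v (suc k)) ≡ true → isPivot (after k v) ≡ false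
  not-pivoted-early k v k≤n early with after k v in ev
  ... | active   = refl
  ... | single _ = refl
  ... | pivot j with subst (λ b → not b ≡ true) pivoted-early early
    where
    pivoted-early : pivotBefore v (suc k) ≡ true
    pivoted-early = trans (pivotBefore-pivot (suc k) (trans (after-stable v k≤n (cong isActive ev)) ev))
                          (T⇒≡true (<⇒<ᵇ (s≤s (pivot-stamp k v j ev))))
  ...   | ()

  neighbour-singled-no-later : ∀ k u v → suc k ≤ n → SingledAt u (suc k) → deg u ≤ deg v →
                               isPivot (after k v) ≡ false → Σ[ j ∈ ℕ ] (final v ≡ single j × pred j ≤ k)
  neighbour-singled-no-later k u v sk≤n su du≤dv unpivoted with after k v in ev
  ... | active = suc k , trans (after-stable v sk≤n (cong isActive v-single)) v-single , ≤-refl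
    where
    open SingledAt su
    -- v has at least u's degree, so it reaches u's threshold in the same iteration.
    v-threshold : (K ≤ᵇ deg v * suc k) ≡ true
    v-threshold = T⇒≡true (≤⇒≤ᵇ (≤-trans (≤ᵇ⇒≤ K _ (≡true⇒T threshold)) (*-monoˡ-≤ (suc k) du≤dv)))
    v-single : after (suc k) v ≡ single (suc k)
    v-single = singletons-simultaneous k u v active-before single-after ev v-threshold
  ... | single j = j , trans (after-stable v (≤-trans (n≤1+n k) sk≤n) (cong isActive ev)) ev
                     , ≤-trans pred[n]≤n (proj₁ (single-stamp k v j ev))

module Charging {n : ℕ} (G : SimpleGraph n) (π : Permutation′ n) (K : ℕ) where
  open SimpleGraph G using (adj) renaming (sym to adj-sym)
  open TruncatedPivot G π K
  open EdgeCounting G π K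
  open Dynamics G π K

  -- A singleton u created in iteration i pays for its edges into N_i(u).
  charge : Status → Fin n → Fin n → Bool
  charge (single i) u v = inN i u v
  charge _          u v = false

  charged : Fin n → Fin n → Bool
  charged u = charge (final u) u

  charged-intro : ∀ {u i v} → final u ≡ single i → inN i u v ≡ true → charged u v ≡ true
  charged-intro {u} {i} {v} fu uv = subst (λ s → charge s u v ≡ true) (sym fu) uv

  inN-intro : ∀ {i u v} → adj u v ≡ true → deg v ≤ deg u → isPivot (atStartOf i v) ≡ false → inN i u v ≡ true
  inN-intro uv dv≤du unpivoted rewrite uv | T⇒≡true (≤⇒≤ᵇ dv≤du) | unpivoted = refl

  singleton-edge-charged : ∀ k u v → final u ≡ single (suc k) → suc k ≤ n → SingledAt u (suc k) →
                           adj u v ≡ true → isPivot (after k v) ≡ false →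
                           (charged u v ≡ true) ⊎ (charged v u ≡ true)
  singleton-edge-charged k u v fu sk≤n su uv v-unpivoted with deg v ≤? deg u
  ... | yes dv≤du = inj₁ (charged-intro fu (inN-intro {suc k} uv dv≤du v-unpivoted))
  ... | no dv≰du with neighbour-singled-no-later k u v sk≤n su (≰⇒≥ dv≰du) v-unpivoted
  ...   | j , fv , pj≤k = inj₂ (charged-intro fv (inN-intro {j} (trans (adj-sym v u) uv) (≰⇒≥ dv≰du) u-unpivoted))
    where
    u-unpivoted : isPivot (after (pred j) u) ≡ false
    u-unpivoted = cong isPivot (active-earlier u pj≤k (SingledAt.active-before su))

  badDir-singleton : ∀ u v → badDir u v ≡ true → Σ[ i ∈ ℕ ] (final u ≡ single i × not (pivotBefore v i) ≡ true)
  badDir-singleton u v bad with final u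
  ... | single i = i , refl , bad

  badDir-charged : ∀ u v → adj u v ≡ true → badDir u v ≡ true → (charged u v ≡ true) ⊎ (charged v u ≡ true)
  badDir-charged u v uv bad with badDir-singleton u v bad
  ... | zero , fu , _ with SingledAt.single-after (proj₂ (single-stamp n u zero fu))
  ...   | ()
  badDir-charged u v uv bad | suc k , fu , early with single-stamp n u (suc k) fu
  ...   | sk≤n , su = singleton-edge-charged k u v fu sk≤n su uv
                        (not-pivoted-early k v (≤-trans (n≤1+n k) sk≤n) early)

  badEdge-charged : ∀ u v → indicator (adj u v ∧ badEdge u v) ≤ indicator (charged u v) + indicator (charged v u)
  badEdge-charged u v with adj u v in uv | badDir u v in buv | badDir v u in bvu
  ... | false | _     | _     = z≤n
  ... | true  | true  | _     = indicator-+-positive (badDir-charged u v uv buv)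
  ... | true  | false | true  = indicator-+-positive (swap (badDir-charged v u (trans (adj-sym v u) uv) bvu))
  ... | true  | false | false = z≤n

  bad-edges-≤-charges : |Ebad| ≤ sumL (λ u → count (charged u) nodes) nodes
  bad-edges-≤-charges = *-cancelˡ-≤ 2 (begin
    2 * |Ebad|
      ≡⟨ double-countEdges badEdge (λ u v → ∨-comm (badDir u v) (badDir v u)) ⟩
    sumL² (λ u v → indicator (adj u v ∧ badEdge u v)) nodes
      ≤⟨ sumL²-mono-≤ badEdge-charged nodes ⟩
    sumL² (λ u v → indicator (charged u v) + indicator (charged v u)) nodes
      ≡⟨ sumL²-symmetrize (λ u v → indicator (charged u v)) nodes ⟩
    2 * sumL² (λ u v → indicator (charged u v)) nodes
      ≡⟨ cong (2 *_) (sumL-cong (λ u → sym (count≡sumL-indicator (charged u) nodes)) nodes) ⟩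
    2 * sumL (λ u → count (charged u) nodes) nodes ∎)
    where open ≤-Reasoning

  singletonAdj : Fin n → Fin n → Bool
  singletonAdj u v = isSingle (final u) ∧ adj u v

  singletonAdj-sinEdge : ∀ u v → indicator (singletonAdj u v) ≤ indicator (adj u v ∧ sinEdge u v)
  singletonAdj-sinEdge u v with isSingle (final u) | adj u v
  ... | true  | true  = ≤-refl
  ... | true  | false = z≤n
  ... | false | _     = z≤n

  singleton-degrees-≤ : sumL (λ u → count (singletonAdj u) nodes) nodes ≤ 2 * |Esin|
  singleton-degrees-≤ = begin
    sumL (λ u → count (singletonAdj u) nodes) nodes
      ≡⟨ sumL-cong (λ u → count≡sumL-indicator (singletonAdj u) nodes) nodes ⟩
    sumL² (λ u v → indicator (singletonAdj u v)) nodes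
      ≤⟨ sumL²-mono-≤ singletonAdj-sinEdge nodes ⟩
    sumL² (λ u v → indicator (adj u v ∧ sinEdge u v)) nodes
      ≡⟨ sym (double-countEdges sinEdge (λ u v → ∨-comm (isSingle (final u)) (isSingle (final v)))) ⟩
    2 * |Esin| ∎
    where open ≤-Reasoning

  charges-bounded : ∀ p q → (∀ i u → final u ≡ single i → q * degAt i u ≤ p * deg u) →
                    ∀ u → q * count (charged u) nodes ≤ p * count (singletonAdj u) nodes
  charges-bounded p q bounded u = by-status (final u) refl
    where
    nothing-charged : q * count (λ _ → false) nodes ≤ p * count (λ _ → false) nodes
    nothing-charged rewrite count-false nodes | *-zeroʳ q = z≤n
    by-status : ∀ s → final u ≡ s → q * count (charge s u) nodes ≤ p * count (λ v → isSingle s ∧ adj u v) nodes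
    by-status (single i) fu = bounded i u fu
    by-status active     _  = nothing-charged
    by-status (pivot _)  _  = nothing-charged

lemma13 : {n : ℕ} (G : SimpleGraph n) (π : Permutation′ n) (K p q : ℕ) → 0 < q →
    ((i : ℕ) (u : Fin n) → TruncatedPivot.final G π K u ≡ single i →
      q * TruncatedPivot.degAt G π K i u ≤ p * TruncatedPivot.deg G π K u) →
    q * TruncatedPivot.|Ebad| G π K ≤ 2 * p * TruncatedPivot.|Esin| G π K
lemma13 G π K p q _ bounded = begin
    q * |Ebad|                                          ≤⟨ *-monoʳ-≤ q bad-edges-≤-charges ⟩
    q * sumL (λ u → count (charged u) nodes) nodes      ≡⟨ *-distribˡ-sumL q _ nodes ⟩
    sumL (λ u → q * count (charged u) nodes) nodes      ≤⟨ sumL-mono-≤ (charges-bounded p q bounded) nodes ⟩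
    sumL (λ u → p * count (singletonAdj u) nodes) nodes ≡⟨ sym (*-distribˡ-sumL p _ nodes) ⟩
    p * sumL (λ u → count (singletonAdj u) nodes) nodes ≤⟨ *-monoʳ-≤ p singleton-degrees-≤ ⟩
    p * (2 * |Esin|)                                    ≡⟨ sym (*-assoc p 2 |Esin|) ⟩
    p * 2 * |Esin|                                      ≡⟨ cong (_* |Esin|) (*-comm p 2) ⟩
    2 * p * |Esin|                                      ∎
  where
  open TruncatedPivot G π K
  open Charging G π K
  open ≤-Reasoning
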